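{- Let $X,Y$ be strings and $k\ge0$, $\alpha\ge1$ integers. Consider the following procedure. For $i\in[0\mathinner{.\,.} k]$ and $j\in[\lfloor -k/\alpha\rfloor-1\mathinner{.\,.}\lfloor k/\alpha\rfloor+1]$ initialize $d'_{i,j}:=d_{i,j}:=-\infty$; set $d'_{0,0}:=0$. For $i=0,1,\ldots,k$: first, for each $j\in[\lfloor -k/\alpha\rfloor\mathinner{.\,.}\lfloor k/\alpha\rfloor]$ with $d'_{i,j}\ne-\infty$, set $d_{i,j}:=d'_{i,j}+\max_{\delta=j\alpha}^{(j+1)\alpha-1}\widetilde{\mathrm{LCE}}_{\alpha-1}^{X,Y}(d'_{i,j},d'_{i,j}+\delta)$; then, for each $j\in[\lfloor -k/\alpha\rfloor\mathinner{.\,.}\lfloor k/\alpha\rfloor]$, set $d'_{i+1,j}:=\min(|X|,\max(d_{i,j-1},d_{i,j}+1,d_{i,j+1}+1))$ (with $-\infty+1=-\infty$). Finally, with $j:=\lfloor\frac1\alpha(|Y|-|X|)\rfloor$, return YES if $||X|-|Y||\le k$ and $d_{k,j}=|X|$, and NO otherwise. Here each value $\widetilde{\mathrm{LCE}}_{\alpha-1}^{X,Y}(\cdot,\cdot)$ may be an arbitrary value satisfying its defining bounds. Then the procedure returns YES if $\mathsf{ED}(X,Y)\le k$ and NO if $\mathsf{ED}(X,Y)>k+3(k+1)(\alpha-1)$.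
   Context: Strings are indexed from $0$; $X[a\mathinner{.\,.} b)=X[a]\cdots X[b-1]$. $\mathsf{HD}$ is Hamming distance, $\mathsf{ED}$ edit distance. For an integer $m\ge0$ and integers $x\in[0\mathinner{.\,.}|X|]$, $y\in[0\mathinner{.\,.}|Y|]$, $\mathrm{LCE}_m^{X,Y}(x,y)$ is the largest integer $\ell\le\min(|X|-x,|Y|-y)$ with $\mathsf{HD}(X[x\mathinner{.\,.} x+\ell),Y[y\mathinner{.\,.} y+\ell))\le m$; if $x\notin[0\mathinner{.\,.}|X|]$ or $y\notin[0\mathinner{.\,.}|Y|]$ it is $0$. $\widetilde{\mathrm{LCE}}_m^{X,Y}(x,y)$ denotes any value $v$ with $\mathrm{LCE}_0^{X,Y}(x,y)\le v\le\mathrm{LCE}_m^{X,Y}(x,y)$. -}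

module Defs where

open import Data.Nat as ℕ using (ℕ; zero; suc; _+_; _*_; _∸_; _⊔_; _⊓_; NonZero)
open import Data.Integer as ℤ using (ℤ; +_; _/ℕ_)
open import Data.List using (List; []; _∷_; length; take; drop)
open import Data.Maybe using (Maybe; just; nothing)
open import Data.Bool using (Bool; true; false; _∧_; if_then_else_)
open import Data.Product using (Σ; _×_; _,_)
open import Relation.Nullary using (¬_; yes; no; Dec)
open import Relation.Nullary.Decidable using (⌊_⌋)
open import Relation.Binary.PropositionalEquality using (_≡_)
open import Relation.Binary.Definitions using (DecidableEquality)

module _ {A : Set} (_≟_ : DecidableEquality A) where

  -- Hamming distance (number of mismatching positions). Only ever
  -- applied to strings of equal length.
  HD : List A → List A → ℕ
  HD (a ∷ as) (b ∷ bs) with a ≟ b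
  ... | yes _ = HD as bs
  ... | no  _ = suc (HD as bs)
  HD _ _ = 0

  cost : A → A → ℕ
  cost a b = if ⌊ a ≟ b ⌋ then 0 else 1

  ED : List A → List A → ℕ
  ED [] ys = length ys
  ED (x ∷ xs) [] = suc (length xs)
  ED (x ∷ xs) (y ∷ ys) =
    (ED xs ys + cost x y) ⊓ (suc (ED xs (y ∷ ys)) ⊓ suc (ED (x ∷ xs) ys))

  sub : List A → ℕ → ℕ → List A
  sub X a ℓ = take ℓ (drop a X)

  IsMaxLCE : ℕ → List A → List A → ℕ → ℕ → ℕ → Set
  IsMaxLCE m X Y x y v =
    v ℕ.≤ length X ∸ x × v ℕ.≤ length Y ∸ y ×
    HD (sub X x v) (sub Y y v) ℕ.≤ m ×
    (∀ ℓ → ℓ ℕ.≤ length X ∸ x → ℓ ℕ.≤ length Y ∸ y →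
       HD (sub X x ℓ) (sub Y y ℓ) ℕ.≤ m → ℓ ℕ.≤ v)

  InRange : List A → List A → ℤ → ℤ → Set
  InRange X Y x y = Σ ℕ λ a → Σ ℕ λ b →
    x ≡ + a × y ≡ + b × a ℕ.≤ length X × b ℕ.≤ length Y

  data IsLCE (m : ℕ) (X Y : List A) : ℤ → ℤ → ℕ → Set where
    inside  : ∀ {a b v} → a ℕ.≤ length X → b ℕ.≤ length Y →
              IsMaxLCE m X Y a b v → IsLCE m X Y (+ a) (+ b) v
    outside : ∀ {x y} → ¬ InRange X Y x y → IsLCE m X Y x y 0

  IsLCE~ : ℕ → List A → List A → ℤ → ℤ → ℕ → Set
  IsLCE~ m X Y x y v = ∀ l₀ lₘ → IsLCE 0 X Y x y l₀ → IsLCE m X Y x y lₘ →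
    l₀ ℕ.≤ v × v ℕ.≤ lₘ

-- The procedure.  -∞ is represented by `nothing`.

ℕ∞ : Set
ℕ∞ = Maybe ℕ

max∞ : ℕ∞ → ℕ∞ → ℕ∞
max∞ nothing b = b
max∞ (just a) nothing = just a
max∞ (just a) (just b) = just (a ⊔ b)

min∞ : ℕ∞ → ℕ∞ → ℕ∞
min∞ nothing _ = nothing
min∞ (just a) nothing = nothing
min∞ (just a) (just b) = just (a ⊓ b)

inc∞ : ℕ∞ → ℕ∞
inc∞ nothing = nothing
inc∞ (just a) = just (suc a)

-- An oracle answers the query for LCE~ at iteration i, diagonal j,
-- shift δ, positions (x, y).  Arbitrary choices (possibly adaptive) are
-- modelled by letting it depend on all of these.
Oracle : Set
Oracle = ℕ → ℤ → ℤ → ℕ → ℤ → ℕ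

ValidOracle : {A : Set} → DecidableEquality A → List A → List A → ℕ → Oracle → Set
ValidOracle _≟_ X Y α O =
  ∀ i j δ x y → IsLCE~ _≟_ (α ∸ 1) X Y (+ x) y (O i j δ x y)

Row : Set
Row = ℤ → ℕ∞

module Procedure (n : ℕ) (k α : ℕ) .{{_ : NonZero α}} (O : Oracle) where
  -- n = |X|
  lo hi : ℤ
  lo = ℤ.- (+ k) /ℕ α
  hi = (+ k) /ℕ α

  inRange? : ℤ → Bool
  inRange? j = ⌊ lo ℤ.≤? j ⌋ ∧ ⌊ j ℤ.≤? hi ⌋

  -- max_{δ = jα}^{(j+1)α-1} O i j δ x (x+δ), via δ = jα + t, t < α
  maxFrom : ℕ → ℤ → ℕ → ℕ → ℕ
  maxFrom i j x zero = 0
  maxFrom i j x (suc t) =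
    let δ = j ℤ.* + α ℤ.+ + t in
    O i j δ x (+ x ℤ.+ δ) ⊔ maxFrom i j x t

  d'₀ : Row
  d'₀ (+ zero) = just 0
  d'₀ _ = nothing

  dStep : ℕ → Row → Row
  dStep i d' j with inRange? j | d' j
  ... | true  | just x  = just (x + maxFrom i j x α)
  ... | _     | _       = nothing

  d'Step : Row → Row
  d'Step d j with inRange? j
  ... | true  = min∞ (just n)
                  (max∞ (d (j ℤ.- + 1)) (max∞ (inc∞ (d j)) (inc∞ (d (j ℤ.+ + 1)))))
  ... | false = nothing

  d' : ℕ → Row
  d  : ℕ → Row
  d' zero = d'₀
  d' (suc i) = d'Step (d i)
  d i = dStep i (d' i)

run : {A : Set} → DecidableEquality A → List A → List A → (k α : ℕ) →
      .{{_ : NonZero α}} → Oracle → Bool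
run _ X Y k α O with ℤ.∣ + length X ℤ.- + length Y ∣ ℕ.≤? k
... | no _ = false
... | yes _ with Procedure.d (length X) k α O k ((+ length Y ℤ.- + length X) /ℕ α)
...   | just v  = ⌊ v ℕ.≟ length X ⌋
...   | nothing = false

module Submission where

-- Alignments are described by the relation  Reach c x y : "X[0..x) can be
-- aligned with Y[0..y) at cost at most c".  It is sound and complete for the
-- edit distance (ED X Y ≤ c iff Reach c |X| |Y|), so both halves of the
-- theorem become statements about Reach.
--
--  * YES.  For every Reach c x y with c ≤ k, the value d_{c,j} on the block
--    j = ⌊(y-x)/α⌋ of that diagonal is at least x.  The induction runs over
--    the derivation of Reach and keeps the stronger invariant for d'_{c,j}:
--    it is either beyond x, or x is reached from it by an exact match along
--    the diagonal (which the LCE~ query, a lower bound for LCE₀, then covers).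
--
--  * NO.  Conversely every finite value v = d_{i,j} is "anchored": X[0..v)
--    aligns with every Y[0..y) at cost  budget i + |y − (v + jα + t)|  for
--    each offset t < α of the block.  An LCE~ answer is at most an LCE_{α−1},
--    so following it costs at most α−1 substitutions; moving between offsets
--    of a block costs at most α−1; and each row step costs 1.  Hence
--    budget i = i + 3(i+1)(α−1), and d_{k,j} = |X| forces ED ≤ budget k.

open import Defs
open import Data.Nat as ℕ using (ℕ; zero; suc; z≤n; s≤s; NonZero)
import Data.Integer as ℤ
open import Data.Integer using (ℤ)
import Data.Nat.Properties as ℕP
open import Data.List using (List; []; _∷_; length; take; drop)
open import Data.List.Properties using (drop-all)
open import Data.Maybe using (just; nothing)
open import Data.Bool using (true; false)
open import Data.Product using (Σ; _×_; _,_; proj₁; proj₂)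
open import Data.Sum using (_⊎_; inj₁; inj₂)
open import Data.Empty using (⊥-elim)
open import Relation.Nullary using (¬_; yes; no; Dec)
open import Relation.Binary.PropositionalEquality
open import Relation.Binary.Definitions using (DecidableEquality)

module ListFacts {A : Set} where

  open import Data.Nat using (_<_; _≤_)

  drop-cons : ∀ x (L : List A) → x < length L → Σ A λ a → drop x L ≡ a ∷ drop (suc x) L
  drop-cons zero    (a ∷ L) _       = a , refl
  drop-cons (suc x) (a ∷ L) (s≤s p) = drop-cons x L p

  drop-suc : ∀ x (L : List A) {a r} → drop x L ≡ a ∷ r → drop (suc x) L ≡ r
  drop-suc zero    (b ∷ L) refl = refl
  drop-suc (suc x) (b ∷ L) e    = drop-suc x L e

  drop-lt : ∀ x (L : List A) {a r} → drop x L ≡ a ∷ r → x < length L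
  drop-lt zero    (b ∷ L) _ = s≤s z≤n
  drop-lt (suc x) (b ∷ L) e = s≤s (drop-lt x L e)

  drop-nil : ∀ x (L : List A) → drop x L ≡ [] → length L ≤ x
  drop-nil zero    []      _ = z≤n
  drop-nil (suc x) []      _ = z≤n
  drop-nil (suc x) (b ∷ L) e = s≤s (drop-nil x L e)

open ListFacts

module ExtendedNat where

  open import Data.Nat using (_≤_; _⊔_)
  open import Data.Nat.Properties using (≤-refl; m≤m⊔n; m≤n⊔m; ⊔-sel)

  max∞-≥ˡ : ∀ u b → Σ ℕ λ w → max∞ (just u) b ≡ just w × u ≤ w
  max∞-≥ˡ u nothing  = u , refl , ≤-refl
  max∞-≥ˡ u (just b) = u ⊔ b , refl , m≤m⊔n u b

  max∞-≥ʳ : ∀ a u → Σ ℕ λ w → max∞ a (just u) ≡ just w × u ≤ w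
  max∞-≥ʳ nothing  u = u , refl , ≤-refl
  max∞-≥ʳ (just a) u = a ⊔ u , refl , m≤n⊔m a u

  max∞-sel : ∀ a b w → max∞ a b ≡ just w → a ≡ just w ⊎ b ≡ just w
  max∞-sel nothing  b        w e = inj₂ e
  max∞-sel (just a) nothing  w e = inj₁ e
  max∞-sel (just a) (just b) w e with ⊔-sel a b
  ... | inj₁ s = inj₁ (trans (cong just (sym s)) e)
  ... | inj₂ s = inj₂ (trans (cong just (sym s)) e)

  inc∞-inv : ∀ a w → inc∞ a ≡ just w → Σ ℕ λ v → a ≡ just v × w ≡ suc v
  inc∞-inv (just v) .(suc v) refl = v , refl , refl

open ExtendedNat

module Alignment {A : Set} (_≟_ : DecidableEquality A) (X Y : List A) where

  open import Data.Nat using (_+_; _≤_; _<_; _⊓_)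
  open import Data.Nat.Properties hiding (_≟_)

  n m : ℕ
  n = length X
  m = length Y

  cost≤1 : ∀ a b → cost _≟_ a b ≤ 1
  cost≤1 a b with a ≟ b
  ... | yes _ = z≤n
  ... | no _  = ≤-refl

  cost-refl : ∀ a → cost _≟_ a a ≡ 0
  cost-refl a with a ≟ a
  ... | yes _ = refl
  ... | no ¬p = ⊥-elim (¬p refl)

  data Reach : ℕ → ℕ → ℕ → Set where
    start      : Reach 0 0 0
    weaken     : ∀ {c x y} → Reach c x y → Reach (suc c) x y
    match      : ∀ {c x y} → Reach c x y → (a : A) → drop x X ≡ a ∷ drop (suc x) X →
                 drop y Y ≡ a ∷ drop (suc y) Y → Reach c (suc x) (suc y)
    substitute : ∀ {c x y} → Reach c x y → x < n → y < m → Reach (suc c) (suc x) (suc y)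
    delete     : ∀ {c x y} → Reach c x y → x < n → Reach (suc c) (suc x) y
    insert     : ∀ {c x y} → Reach c x y → y < m → Reach (suc c) x (suc y)

  reach-bounded : ∀ {c x y} → Reach c x y → x ≤ n × y ≤ m
  reach-bounded start              = z≤n , z≤n
  reach-bounded (weaken r)         = reach-bounded r
  reach-bounded (match r a e₁ e₂)  = drop-lt _ X e₁ , drop-lt _ Y e₂
  reach-bounded (substitute r p q) = p , q
  reach-bounded (delete r p)       = p , proj₂ (reach-bounded r)
  reach-bounded (insert r q)       = proj₁ (reach-bounded r) , q

  reach-diagonal : ∀ {c x y} → Reach c x y → x ≤ y + c × y ≤ x + c
  reach-diagonal start = z≤n , z≤n
  reach-diagonal (weaken {c} {x} {y} r) = let (p , q) = reach-diagonal r in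
    ≤-trans p (+-monoʳ-≤ y (n≤1+n c)) , ≤-trans q (+-monoʳ-≤ x (n≤1+n c))
  reach-diagonal (match r _ _ _) = let (p , q) = reach-diagonal r in s≤s p , s≤s q
  reach-diagonal (substitute r _ _) = let (p , q) = reach-diagonal r in
    s≤s (≤-trans p (+-monoʳ-≤ _ (n≤1+n _))) , s≤s (≤-trans q (+-monoʳ-≤ _ (n≤1+n _)))
  reach-diagonal (delete {c} {x} {y} r _) = let (p , q) = reach-diagonal r in
    subst (suc x ≤_) (sym (+-suc y c)) (s≤s p) ,
    ≤-trans q (≤-trans (+-monoʳ-≤ x (n≤1+n c)) (n≤1+n _))
  reach-diagonal (insert {c} {x} {y} r _) = let (p , q) = reach-diagonal r in
    ≤-trans p (≤-trans (+-monoʳ-≤ y (n≤1+n c)) (n≤1+n _)) ,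
    subst (suc y ≤_) (sym (+-suc x c)) (s≤s q)

  reach-mono : ∀ {c c' x y} → c ≤ c' → Reach c x y → Reach c' x y
  reach-mono p r = go (≤⇒≤′ p) r
    where
    go : ∀ {c c' x y} → c ℕ.≤′ c' → Reach c x y → Reach c' x y
    go ℕ.≤′-refl     r = r
    go (ℕ.≤′-step q) r = weaken (go q r)

  EDsuffix : ℕ → ℕ → ℕ
  EDsuffix x y = ED _≟_ (drop x X) (drop y Y)

  ED-nil : ∀ (as : List A) → ED _≟_ as [] ≡ length as
  ED-nil []      = refl
  ED-nil (a ∷ as) = refl

  -- Each edit step is paid for by
  -- one Levenshtein recurrence step on the suffixes.
  ED≤reach+suffix : ∀ {c x y} → Reach c x y → ED _≟_ X Y ≤ c + EDsuffix x y
  ED≤reach+suffix start      = ≤-refl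
  ED≤reach+suffix (weaken r) = ≤-trans (ED≤reach+suffix r) (n≤1+n _)
  ED≤reach+suffix {c} (match {x = x} {y = y} r a e₁ e₂) =
    ≤-trans (ED≤reach+suffix r) (+-monoʳ-≤ c step)
    where
    step : EDsuffix x y ≤ EDsuffix (suc x) (suc y)
    step rewrite e₁ | e₂ = ≤-trans (m⊓n≤m _ _)
      (≤-reflexive (trans (cong (EDsuffix (suc x) (suc y) +_) (cost-refl a)) (+-identityʳ _)))
  ED≤reach+suffix (substitute {c} {x} {y} r p q) with drop-cons x X p | drop-cons y Y q
  ... | a , e₁ | b , e₂ =
    ≤-trans (ED≤reach+suffix r) (≤-trans (+-monoʳ-≤ c step) (≤-reflexive (+-suc c _)))
    where
    step : EDsuffix x y ≤ suc (EDsuffix (suc x) (suc y))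
    step rewrite e₁ | e₂ = ≤-trans (m⊓n≤m _ _)
      (≤-trans (+-monoʳ-≤ (EDsuffix (suc x) (suc y)) (cost≤1 a b)) (≤-reflexive (+-comm _ 1)))
  ED≤reach+suffix (delete {c} {x} {y} r p) with drop-cons x X p
  ... | a , e₁ =
    ≤-trans (ED≤reach+suffix r) (≤-trans (+-monoʳ-≤ c step) (≤-reflexive (+-suc c _)))
    where
    step : EDsuffix x y ≤ suc (EDsuffix (suc x) y)
    step rewrite e₁ with drop y Y
    ... | []     = ≤-reflexive (cong suc (sym (ED-nil (drop (suc x) X))))
    ... | b ∷ bs = ≤-trans (m⊓n≤n _ _) (m⊓n≤m _ _)
  ED≤reach+suffix (insert {c} {x} {y} r q) with drop-cons y Y q
  ... | b , e₂ =
    ≤-trans (ED≤reach+suffix r) (≤-trans (+-monoʳ-≤ c step) (≤-reflexive (+-suc c _)))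
    where
    step : EDsuffix x y ≤ suc (EDsuffix x (suc y))
    step rewrite e₂ with drop x X
    ... | []     = ≤-refl
    ... | a ∷ as = ≤-trans (m⊓n≤n _ _) (m⊓n≤n _ _)

  ⊓₃-elim : (P : ℕ → Set) → ∀ a b c → P a → P b → P c → P (a ⊓ (b ⊓ c))
  ⊓₃-elim P a b c pa pb pc with ⊓-sel a (b ⊓ c)
  ... | inj₁ e = subst P (sym e) pa
  ... | inj₂ e with ⊓-sel b c
  ...   | inj₁ e' = subst P (sym (trans e e')) pb
  ...   | inj₂ e' = subst P (sym (trans e e')) pc

  -- Completeness: any alignment of the prefixes extends, following the
  -- Levenshtein recurrence on the suffixes xs = X[x..), ys = Y[y..), to an
  -- alignment of the whole strings.
  reach-extend : ∀ (xs ys : List A) {c x y} → drop x X ≡ xs → drop y Y ≡ ys →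
                 Reach c x y → Reach (c + ED _≟_ xs ys) n m
  reach-extend [] [] {c} {x} {y} e₁ e₂ r =
    let (p , q) = reach-bounded r in
    subst₂ (Reach (c + 0)) (≤-antisym p (drop-nil x X e₁)) (≤-antisym q (drop-nil y Y e₂))
      (subst (λ z → Reach z x y) (sym (+-identityʳ c)) r)
  reach-extend [] (b ∷ bs) {c} {x} {y} e₁ e₂ r =
    subst (λ z → Reach z n m) (sym (+-suc c (length bs)))
      (reach-extend [] bs e₁ (drop-suc y Y e₂) (insert r (drop-lt y Y e₂)))
  reach-extend (a ∷ as) [] {c} {x} {y} e₁ e₂ r =
    subst (λ z → Reach z n m) (trans (cong (suc c +_) (ED-nil as)) (sym (+-suc c (length as))))
      (reach-extend as [] (drop-suc x X e₁) e₂ (delete r (drop-lt x X e₁)))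
  reach-extend (a ∷ as) (b ∷ bs) {c} {x} {y} e₁ e₂ r =
    ⊓₃-elim (λ z → Reach (c + z) n m) _ _ _ diagonal
      (subst (λ z → Reach z n m) (sym (+-suc c _))
        (reach-extend as (b ∷ bs) (drop-suc x X e₁) e₂ (delete r (drop-lt x X e₁))))
      (subst (λ z → Reach z n m) (sym (+-suc c _))
        (reach-extend (a ∷ as) bs e₁ (drop-suc y Y e₂) (insert r (drop-lt y Y e₂))))
    where
    diagonal : Reach (c + (ED _≟_ as bs + cost _≟_ a b)) n m
    diagonal with a ≟ b
    ... | yes refl = subst (λ z → Reach (c + z) n m) (sym (+-identityʳ _))
          (reach-extend as bs (drop-suc x X e₁) (drop-suc y Y e₂)
            (match r a (trans e₁ (cong (a ∷_) (sym (drop-suc x X e₁))))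
                       (trans e₂ (cong (a ∷_) (sym (drop-suc y Y e₂))))))
    ... | no _ = subst (λ z → Reach z n m) (trans (sym (+-suc c _)) (cong (c +_) (+-comm 1 _)))
          (reach-extend as bs (drop-suc x X e₁) (drop-suc y Y e₂)
            (substitute r (drop-lt x X e₁) (drop-lt y Y e₂)))

  reach-of-ED : Reach (ED _≟_ X Y) n m
  reach-of-ED = reach-extend X Y refl refl start

  ED≤reach : ∀ {c} → Reach c n m → ED _≟_ X Y ≤ c
  ED≤reach {c} r = subst (ED _≟_ X Y ≤_) (trans (cong (c +_) suffix-empty) (+-identityʳ c))
                     (ED≤reach+suffix r)
    where
    suffix-empty : EDsuffix n m ≡ 0
    suffix-empty rewrite drop-all n X ≤-refl | drop-all m Y ≤-refl = refl

module Windows {A : Set} (_≟_ : DecidableEquality A) (X Y : List A) where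

  open import Data.Nat using (_+_; _∸_; _≤_; _≤?_; _⊓_)
  open import Data.Nat.Properties hiding (_≟_)

  open Alignment _≟_ X Y
  open import Data.Integer using (+_)

  mismatches : ℕ → ℕ → ℕ → ℕ
  mismatches ℓ x y = HD _≟_ (take ℓ (drop x X)) (take ℓ (drop y Y))

  HD-prefix-mono : ∀ (xs ys : List A) ℓ ℓ' → ℓ ≤ ℓ' →
    HD _≟_ (take ℓ xs) (take ℓ ys) ≤ HD _≟_ (take ℓ' xs) (take ℓ' ys)
  HD-prefix-mono xs       ys       zero    ℓ'       _ = z≤n
  HD-prefix-mono []       ys       (suc ℓ) (suc ℓ') _ = z≤n
  HD-prefix-mono (a ∷ xs) []       (suc ℓ) (suc ℓ') _ = z≤n
  HD-prefix-mono (a ∷ xs) (b ∷ ys) (suc ℓ) (suc ℓ') (s≤s p) with a ≟ b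
  ... | yes _ = HD-prefix-mono xs ys ℓ ℓ' p
  ... | no _  = s≤s (HD-prefix-mono xs ys ℓ ℓ' p)

  -- Following a diagonal window with at most h mismatches costs at most h:
  -- matches are free, mismatches are substitutions.
  reach-along-diagonal : ∀ ℓ {c h x y} → Reach c x y → mismatches ℓ x y ≤ h →
    x + ℓ ≤ n → y + ℓ ≤ m → Reach (c + h) (x + ℓ) (y + ℓ)
  reach-along-diagonal zero {c} {h} {x} {y} r _ _ _ =
    subst₂ (Reach (c + h)) (sym (+-identityʳ x)) (sym (+-identityʳ y)) (reach-mono (m≤m+n c h) r)
  reach-along-diagonal (suc ℓ) {c} {h} {x} {y} r H p q
    with drop-cons x X (≤-trans (s≤s (m≤m+n x ℓ)) (≤-trans (≤-reflexive (sym (+-suc x ℓ))) p))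
       | drop-cons y Y (≤-trans (s≤s (m≤m+n y ℓ)) (≤-trans (≤-reflexive (sym (+-suc y ℓ))) q))
  ... | a , e₁ | b , e₂ = step (a ≟ b) H'
    where
    H' : HD _≟_ (a ∷ take ℓ (drop (suc x) X)) (b ∷ take ℓ (drop (suc y) Y)) ≤ h
    H' = subst₂ (λ L M → HD _≟_ (take (suc ℓ) L) (take (suc ℓ) M) ≤ h) e₁ e₂ H
    p' : suc x + ℓ ≤ n
    p' = subst (_≤ n) (+-suc x ℓ) p
    q' : suc y + ℓ ≤ m
    q' = subst (_≤ m) (+-suc y ℓ) q
    shift : ∀ {c'} → Reach c' (suc x + ℓ) (suc y + ℓ) → Reach c' (x + suc ℓ) (y + suc ℓ)
    shift = subst₂ (Reach _) (sym (+-suc x ℓ)) (sym (+-suc y ℓ))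
    step : Dec (a ≡ b) → HD _≟_ (a ∷ take ℓ (drop (suc x) X)) (b ∷ take ℓ (drop (suc y) Y)) ≤ h →
           Reach (c + h) (x + suc ℓ) (y + suc ℓ)
    step (yes refl) H'' with a ≟ a
    ... | yes _ = shift (reach-along-diagonal ℓ (match r a e₁ e₂) H'' p' q')
    ... | no ¬p = ⊥-elim (¬p refl)
    step (no a≢b) H'' with a ≟ b
    ... | yes a≡b = ⊥-elim (a≢b a≡b)
    step (no a≢b) (s≤s H'') | no _ = subst (λ z → Reach z (x + suc ℓ) (y + suc ℓ)) (sym (+-suc c _))
        (shift (reach-along-diagonal ℓ (substitute r (drop-lt x X e₁) (drop-lt y Y e₂)) H'' p' q'))

  data ExactRun : ℕ → ℕ → ℕ → Set where
    empty : ∀ {a b} → ExactRun a b 0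
    cons  : ∀ {a b ℓ} (c : A) → drop a X ≡ c ∷ drop (suc a) X → drop b Y ≡ c ∷ drop (suc b) Y →
            ExactRun (suc a) (suc b) ℓ → ExactRun a b (suc ℓ)

  exactRun-snoc : ∀ {a b ℓ} → ExactRun a b ℓ → (c : A) →
    drop (a + ℓ) X ≡ c ∷ drop (suc (a + ℓ)) X → drop (b + ℓ) Y ≡ c ∷ drop (suc (b + ℓ)) Y →
    ExactRun a b (suc ℓ)
  exactRun-snoc {a} {b} empty c e₁ e₂ =
    cons c (subst (λ z → drop z X ≡ c ∷ drop (suc z) X) (+-identityʳ a) e₁)
           (subst (λ z → drop z Y ≡ c ∷ drop (suc z) Y) (+-identityʳ b) e₂) empty
  exactRun-snoc {a} {b} (cons {ℓ = ℓ} c' e₁' e₂' r) c e₁ e₂ =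
    cons c' e₁' e₂' (exactRun-snoc r c
      (subst (λ z → drop z X ≡ c ∷ drop (suc z) X) (+-suc a ℓ) e₁)
      (subst (λ z → drop z Y ≡ c ∷ drop (suc z) Y) (+-suc b ℓ) e₂))

  exactRun-window : ∀ {a b ℓ} → a ≤ n → b ≤ m → ExactRun a b ℓ →
    mismatches ℓ a b ≤ 0 × a + ℓ ≤ n × b + ℓ ≤ m
  exactRun-window {a} {b} p q empty =
    z≤n , subst (_≤ n) (sym (+-identityʳ a)) p , subst (_≤ m) (sym (+-identityʳ b)) q
  exactRun-window {a} {b} p q (cons {ℓ = ℓ} c e₁ e₂ r) =
    let (_ , u , v) = rest in
    head-matches , subst (_≤ n) (sym (+-suc a ℓ)) u , subst (_≤ m) (sym (+-suc b ℓ)) v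
    where
    rest = exactRun-window (drop-lt a X e₁) (drop-lt b Y e₂) r
    head-matches : mismatches (suc ℓ) a b ≤ 0
    head-matches rewrite e₁ | e₂ with c ≟ c
    ... | yes _ = proj₁ rest
    ... | no ¬p = ⊥-elim (¬p refl)

  bounded-max : (P : ℕ → Set) → (∀ ℓ → Dec (P ℓ)) → P 0 → ∀ N →
                Σ ℕ λ v → v ≤ N × P v × (∀ ℓ → ℓ ≤ N → P ℓ → ℓ ≤ v)
  bounded-max P P? P0 zero = 0 , z≤n , P0 , λ { .0 z≤n _ → z≤n }
  bounded-max P P? P0 (suc N) with P? (suc N)
  ... | yes p = suc N , ≤-refl , p , λ ℓ q _ → q
  ... | no ¬p with bounded-max P P? P0 N
  ...   | v , v≤ , pv , maximal = v , m≤n⇒m≤1+n v≤ , pv , below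
    where
    below : ∀ ℓ → ℓ ≤ suc N → P ℓ → ℓ ≤ v
    below ℓ q pℓ with m≤n⇒m<n∨m≡n q
    ... | inj₁ (s≤s l) = maximal ℓ l pℓ
    ... | inj₂ refl    = ⊥-elim (¬p pℓ)

  LCE-exists : ∀ w a b → Σ ℕ λ v → IsMaxLCE _≟_ w X Y a b v
  LCE-exists w a b
    with bounded-max (λ ℓ → mismatches ℓ a b ≤ w) (λ ℓ → mismatches ℓ a b ≤? w) z≤n ((n ∸ a) ⊓ (m ∸ b))
  ... | v , v≤ , pv , maximal =
    v , ≤-trans v≤ (m⊓n≤m _ _) , ≤-trans v≤ (m⊓n≤n _ _) , pv , λ ℓ p q h → maximal ℓ (⊓-glb p q) h

  record Answer (W x y o : ℕ) : Set where
    field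
      fitsX         : x + o ≤ n
      fitsY         : y + o ≤ m
      fewMismatches : mismatches o x y ≤ W
      coversExact   : ∀ ℓ → x + ℓ ≤ n → y + ℓ ≤ m → mismatches ℓ x y ≤ 0 → ℓ ≤ o

  answer-inside : ∀ {W x y o} → IsLCE~ _≟_ W X Y (+ x) (+ y) o → x ≤ n → y ≤ m → Answer W x y o
  answer-inside {W} {x} {y} {o} V xn ym =
    let (l₀ , l₀n , l₀m , l₀h , l₀max) = LCE-exists 0 x y
        (lW , lWn , lWm , lWh , lWmax) = LCE-exists W x y
        (lower , upper) = V l₀ lW (inside xn ym (l₀n , l₀m , l₀h , l₀max))
                                   (inside xn ym (lWn , lWm , lWh , lWmax))
    in record
      { fitsX         = +-fits xn (≤-trans upper lWn)
      ; fitsY         = +-fits ym (≤-trans upper lWm)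
      ; fewMismatches = ≤-trans (HD-prefix-mono (drop x X) (drop y Y) o lW upper) lWh
      ; coversExact   = λ ℓ p q h → ≤-trans (l₀max ℓ (∸-fits p) (∸-fits q) h) lower
      }
    where
    +-fits : ∀ {v x N} → x ≤ N → v ≤ N ∸ x → x + v ≤ N
    +-fits {v} {x} {N} p q = subst (_≤ N) (+-comm v x) (m≤o∸n⇒m+n≤o v p q)
    ∸-fits : ∀ {ℓ x N} → x + ℓ ≤ N → ℓ ≤ N ∸ x
    ∸-fits {ℓ} {x} {N} p = m+n≤o⇒m≤o∸n ℓ (subst (_≤ N) (+-comm x ℓ) p)

  answer-outside : ∀ {W z o x} → ¬ InRange _≟_ X Y (+ x) z → IsLCE~ _≟_ W X Y (+ x) z o → o ≡ 0
  answer-outside out V = n≤0⇒n≡0 (proj₂ (V 0 0 (outside out) (outside out)))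

  answer-cases : ∀ {W x z o} → IsLCE~ _≟_ W X Y (+ x) z o → x ≤ n →
    (Σ ℕ λ y → z ≡ + y × Answer W x y o) ⊎ o ≡ 0
  answer-cases {z = + y} V xn with y ≤? m
  ... | yes ym = inj₁ (y , refl , answer-inside V xn ym)
  ... | no ¬ym = inj₂ (answer-outside (λ { (_ , _ , _ , refl , _ , q) → ¬ym q }) V)
  answer-cases {z = ℤ.-[1+ _ ]} V xn = inj₂ (answer-outside (λ { (_ , _ , _ , () , _ , _) }) V)

  answer-fits : ∀ {W x z o} → IsLCE~ _≟_ W X Y (+ x) z o → x ≤ n → x + o ≤ n
  answer-fits V xn with answer-cases V xn
  ... | inj₁ (_ , _ , a) = Answer.fitsX a
  ... | inj₂ refl        = subst (_≤ n) (sym (+-identityʳ _)) xn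

-- Anchored reachability: X[0..v) aligns with every prefix of Y at a cost
-- growing by one per unit of distance from a reference column z.
module Anchoring {A : Set} (_≟_ : DecidableEquality A) (X Y : List A) where

  open import Data.Nat using (∣_-_∣; _+_; _∸_; _≤_; _<_)
  open import Data.Nat.Properties hiding (_≟_)

  open Alignment _≟_ X Y
  open import Data.Integer using (+_)

  -- Cutting the last y − y' letters of Y off an alignment costs at most
  -- y − y': matched/substituted letters of Y become deletions in X,
  -- inserted ones disappear.
  reach-shorten : ∀ {c x y y'} → Reach c x y → y' ≤ y → Reach (c + (y ∸ y')) x y'
  reach-shorten start z≤n = start
  reach-shorten (weaken r) le = weaken (reach-shorten r le)
  reach-shorten {c} {suc x} {suc y} {y'} (match r a e₁ e₂) le with m≤n⇒m<n∨m≡n le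
  ... | inj₂ refl = subst (λ z → Reach z (suc x) (suc y))
                      (sym (trans (cong (_+_ c) (n∸n≡0 y)) (+-identityʳ c))) (match r a e₁ e₂)
  ... | inj₁ (s≤s le') =
    reach-mono (≤-reflexive (trans (sym (+-suc c _)) (cong (_+_ c) (sym (+-∸-assoc 1 le')))))
      (delete (reach-shorten r le') (drop-lt x X e₁))
  reach-shorten {suc c} {suc x} {suc y} {y'} (substitute r p q) le with m≤n⇒m<n∨m≡n le
  ... | inj₂ refl = reach-mono (m≤m+n _ _) (substitute r p q)
  ... | inj₁ (s≤s le') =
    reach-mono (s≤s (+-monoʳ-≤ c (∸-monoˡ-≤ y' (n≤1+n y)))) (delete (reach-shorten r le') p)
  reach-shorten (delete r p) le = delete (reach-shorten r le) p
  reach-shorten {suc c} {x} {suc y} {y'} (insert r q) le with m≤n⇒m<n∨m≡n le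
  ... | inj₂ refl = reach-mono (m≤m+n _ _) (insert r q)
  ... | inj₁ (s≤s le') =
    reach-mono (s≤s (+-monoʳ-≤ c (∸-monoˡ-≤ y' (n≤1+n y)))) (weaken (reach-shorten r le'))

  reach-lengthen : ∀ s {c x y} → Reach c x y → y + s ≤ m → Reach (c + s) x (y + s)
  reach-lengthen zero {c} {x} {y} r _ =
    subst₂ (λ a b → Reach a x b) (sym (+-identityʳ c)) (sym (+-identityʳ y)) r
  reach-lengthen (suc s) {c} {x} {y} r p =
    subst₂ (λ a b → Reach a x b) (sym (+-suc c s)) (sym (+-suc y s))
      (reach-lengthen s (insert r (≤-trans (s≤s (m≤m+n y s)) p')) p')
    where
    p' : suc y + s ≤ m
    p' = subst (_≤ m) (+-suc y s) p

  dist : ℕ → ℤ → ℕ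
  dist y (+ b)        = ∣ y - b ∣
  dist y ℤ.-[1+ _ ] = y

  record Anchored (c v : ℕ) (z : ℤ) : Set where
    constructor anchored
    field reachAt : ∀ y → y ≤ m → Reach (c + dist y z) v y
  open Anchored public

  anchored-of-reach : ∀ {c v b} → Reach c v b → Anchored c v (+ b)
  anchored-of-reach {c} {v} {b} r = anchored column
    where
    column : ∀ y → y ≤ m → Reach (c + dist y (+ b)) v y
    column y ym with ≤-total y b
    ... | inj₁ yb = subst (λ z → Reach (c + z) v y) (sym (m≤n⇒∣m-n∣≡n∸m yb)) (reach-shorten r yb)
    ... | inj₂ by = subst₂ (λ z w → Reach (c + z) v w) (sym (m≤n⇒∣n-m∣≡n∸m by)) (m+[n∸m]≡n by)
                      (reach-lengthen (y ∸ b) r (subst (_≤ m) (sym (m+[n∸m]≡n by)) ym))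

  reach-of-anchored : ∀ {c v b} → Anchored c v (+ b) → b ≤ m → Reach c v b
  reach-of-anchored {c} {v} {b} G bm =
    subst (λ z → Reach z v b) (trans (cong (_+_ c) (trans (m≤n⇒∣m-n∣≡n∸m (≤-refl {b})) (n∸n≡0 b)))
                                     (+-identityʳ c))
      (reachAt G b bm)

  anchored-mono : ∀ {c c' v z} → c ≤ c' → Anchored c v z → Anchored c' v z
  anchored-mono le G = anchored λ y ym → reach-mono (+-monoˡ-≤ _ le) (reachAt G y ym)

  ∣b-1+b∣≡1 : ∀ b → ∣ b - suc b ∣ ≡ 1
  ∣b-1+b∣≡1 zero    = refl
  ∣b-1+b∣≡1 (suc b) = ∣b-1+b∣≡1 b

  dist-suc-≤ : ∀ y z → dist y (ℤ.suc z) ≤ suc (dist y z)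
  dist-suc-≤ y (+ b) = ≤-trans (∣-∣-triangle y b (suc b))
    (≤-reflexive (trans (cong (_+_ ∣ y - b ∣) (∣b-1+b∣≡1 b)) (+-comm _ 1)))
  dist-suc-≤ y ℤ.-[1+ zero ]  = ≤-trans (≤-reflexive (∣-∣-identityʳ y)) (n≤1+n y)
  dist-suc-≤ y ℤ.-[1+ suc _ ] = n≤1+n y

  dist-≤-suc : ∀ y z → dist y z ≤ suc (dist y (ℤ.suc z))
  dist-≤-suc y (+ b) = ≤-trans (∣-∣-triangle y (suc b) b)
    (≤-reflexive (trans (cong (_+_ ∣ y - suc b ∣) (trans (∣-∣-comm (suc b) b) (∣b-1+b∣≡1 b)))
                        (+-comm _ 1)))
  dist-≤-suc y ℤ.-[1+ zero ]  = ≤-trans (≤-reflexive (sym (∣-∣-identityʳ y))) (n≤1+n _)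
  dist-≤-suc y ℤ.-[1+ suc _ ] = n≤1+n y

  anchored-up : ∀ {c v z} → Anchored c v z → Anchored (suc c) v (ℤ.suc z)
  anchored-up {c} {v} {z} G = anchored λ y ym →
    reach-mono (≤-trans (+-monoʳ-≤ c (dist-≤-suc y z)) (≤-reflexive (+-suc c _))) (reachAt G y ym)

  anchored-down : ∀ {c v z} → Anchored c v (ℤ.suc z) → Anchored (suc c) v z
  anchored-down {c} {v} {z} G = anchored λ y ym →
    reach-mono (≤-trans (+-monoʳ-≤ c (dist-suc-≤ y z)) (≤-reflexive (+-suc c _))) (reachAt G y ym)

  -- A diagonal step (substitution, or deletion at column 0) costs one.
  anchored-substitute : ∀ {c v z} → Anchored c v z → v < n → Anchored (suc c) (suc v) (ℤ.suc z)
  anchored-substitute {c} {v} {z} G vn = anchored column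
    where
    dist-0 : ∀ z → dist 0 z ≤ dist 0 (ℤ.suc z)
    dist-0 (+ b)        = n≤1+n b
    dist-0 ℤ.-[1+ _ ] = z≤n
    dist-diag : ∀ y z → dist y z ≤ dist (suc y) (ℤ.suc z)
    dist-diag y (+ b)              = ≤-refl
    dist-diag y ℤ.-[1+ zero ]  = n≤1+n y
    dist-diag y ℤ.-[1+ suc _ ] = n≤1+n y
    column : ∀ y → y ≤ m → Reach (suc c + dist y (ℤ.suc z)) (suc v) y
    column zero    _  = reach-mono (s≤s (+-monoʳ-≤ c (dist-0 z))) (delete (reachAt G 0 z≤n) vn)
    column (suc y) ym = reach-mono (s≤s (+-monoʳ-≤ c (dist-diag y z)))
                          (substitute (reachAt G y (≤-trans (n≤1+n y) ym)) vn ym)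

  anchored-delete : ∀ {c v z} → Anchored c v z → v < n → Anchored (suc c) (suc v) z
  anchored-delete G vn = anchored λ y ym → delete (reachAt G y ym) vn

-- Block arithmetic on diagonals.  With α = W + 1, diagonal δ = y − x lies in
-- block ⌊δ/α⌋, and the α diagonals of block j are the shifts jα + t, t < α.
module Blocks (W : ℕ) where

  open import Data.Integer
    using (+_; -[1+_]; _+_; _*_; _-_; -_; _≤_; _<_; _/ℕ_; _%ℕ_; +≤+; +<+)
  open import Data.Integer.Properties
  open import Data.Integer.DivMod using (a≡a%ℕn+[a/ℕn]*n; n%ℕd<d)
  open import Data.Integer.Tactic.RingSolver using (solve-∀)
  open import Relation.Binary using (tri<; tri≈; tri>)

  α : ℕ
  α = suc W

  block : ℤ → ℤ
  block z = z /ℕ α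

  offset : ℤ → ℕ
  offset z = z %ℕ α

  offset<α : ∀ z → offset z ℕ.< α
  offset<α z = n%ℕd<d z α

  block-decomp : ∀ z → z ≡ + offset z + block z * + α
  block-decomp z = a≡a%ℕn+[a/ℕn]*n z α

  private
    below-next-block : ∀ r q j → r ℕ.< α → q < j → + r + q * + α < j * + α
    below-next-block r q j r<α q<j = begin-strict
        + r + q * + α       <⟨ +-monoˡ-< (q * + α) (+<+ r<α) ⟩
        + α + q * + α       ≡⟨ identity (+ α) q ⟩
        (+ 1 + q) * + α     ≤⟨ *-monoʳ-≤-nonNeg (+ α) (i<j⇒suc[i]≤j q<j) ⟩
        j * + α ∎
      where
      open ≤-Reasoning
      identity : ∀ a q → a + q * a ≡ (+ 1 + q) * a
      identity = solve-∀

    quotient-unique : ∀ r q t j → r ℕ.< α → t ℕ.< α → + r + q * + α ≡ + t + j * + α → q ≡ j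
    quotient-unique r q t j r< t< e with <-cmp q j
    ... | tri≈ _ q≡j _ = q≡j
    ... | tri< q<j _ _ = ⊥-elim (<-irrefl e
          (<-≤-trans (below-next-block r q j r< q<j) (i≤j+i (j * + α) (+ t))))
    ... | tri> _ _ j<q = ⊥-elim (<-irrefl (sym e)
          (<-≤-trans (below-next-block t j q t< j<q) (i≤j+i (q * + α) (+ r))))

  block-of : ∀ z t j → t ℕ.< α → z ≡ + t + j * + α → block z ≡ j
  block-of z t j t< e =
    quotient-unique (z %ℕ α) (block z) t j (n%ℕd<d z α) t< (trans (sym (block-decomp z)) e)

  block-mono : ∀ z z' → z ≤ z' → block z ≤ block z'
  block-mono z z' z≤z' with <-cmp (block z) (block z')
  ... | tri< lt _ _ = <⇒≤ lt
  ... | tri≈ _ eq _ = ≤-reflexive eq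
  ... | tri> _ _ gt = ⊥-elim (<-irrefl refl
          (<-≤-trans (below-next-block (z' %ℕ α) (block z') (block z) (n%ℕd<d z' α) gt) bound))
    where
    bound : block z * + α ≤ + (z' %ℕ α) + block z' * + α
    bound = begin
        block z * + α                  ≤⟨ i≤j+i _ (+ (z %ℕ α)) ⟩
        + (z %ℕ α) + block z * + α     ≡⟨ sym (block-decomp z) ⟩
        z                              ≤⟨ z≤z' ⟩
        z'                             ≡⟨ block-decomp z' ⟩
        + (z' %ℕ α) + block z' * + α ∎
      where open ≤-Reasoning

  block-pred : ∀ z → block (z - + 1) ≡ block z ⊎ block (z - + 1) + + 1 ≡ block z
  block-pred z with z %ℕ α in eq
  ... | zero = inj₂ (trans (cong (_+ + 1) previous) (identity₁ (block z)))
    where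
    identity₁ : ∀ q → q - + 1 + + 1 ≡ q
    identity₁ = solve-∀
    identity₂ : ∀ q w → (+ 0 + q * (+ 1 + w)) - + 1 ≡ w + (q - + 1) * (+ 1 + w)
    identity₂ = solve-∀
    previous : block (z - + 1) ≡ block z - + 1
    previous = block-of _ W (block z - + 1) ℕP.≤-refl
      (trans (cong (_- + 1) (trans (block-decomp z) (cong (λ r → + r + block z * + α) eq)))
             (identity₂ (block z) (+ W)))
  ... | suc r = inj₁ (block-of _ r (block z) (ℕP.<-trans (ℕP.n<1+n r) r<α)
      (trans (cong (_- + 1) (trans (block-decomp z) (cong (λ r → + r + block z * + α) eq)))
             (identity (+ r) (block z * + α))))
    where
    identity : ∀ r b → (+ 1 + r + b) - + 1 ≡ r + b
    identity = solve-∀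
    r<α : suc r ℕ.< α
    r<α = subst (ℕ._< α) eq (n%ℕd<d z α)

  block-suc : ∀ z → block (z + + 1) ≡ block z ⊎ block (z + + 1) - + 1 ≡ block z
  block-suc z with ℕP.m≤n⇒m<n∨m≡n (n%ℕd<d z α)
  ... | inj₁ (s≤s lt) = inj₁ (block-of _ (suc (z %ℕ α)) (block z) (s≤s lt)
      (trans (cong (_+ + 1) (block-decomp z)) (identity (+ (z %ℕ α)) (block z * + α))))
    where
    identity : ∀ r b → r + b + + 1 ≡ (+ 1 + r) + b
    identity = solve-∀
  ... | inj₂ eq = inj₂ (trans (cong (_- + 1) next) (identity₁ (block z)))
    where
    identity₁ : ∀ q → q + + 1 - + 1 ≡ q
    identity₁ = solve-∀
    identity₂ : ∀ q w → (w + q * (+ 1 + w)) + + 1 ≡ + 0 + (q + + 1) * (+ 1 + w)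
    identity₂ = solve-∀
    next : block (z + + 1) ≡ block z + + 1
    next = block-of _ 0 (block z + + 1) (s≤s z≤n)
      (trans (cong (_+ + 1) (trans (block-decomp z)
                                   (cong (λ r → + r + block z * + α) (ℕP.suc-injective eq))))
             (identity₂ (block z) (+ W)))

  diag : ℕ → ℕ → ℤ
  diag x y = + y - + x

  shift : ℤ → ℕ → ℤ
  shift j t = j * + α + + t

  column : ℕ → ℤ → ℕ → ℤ
  column v j t = + v + shift j t

  diag-match : ∀ x y → diag (suc x) (suc y) ≡ diag x y
  diag-match x y = identity (+ x) (+ y)
    where
    identity : ∀ x y → (+ 1 + y) - (+ 1 + x) ≡ y - x
    identity = solve-∀

  diag-delete : ∀ x y → diag (suc x) y ≡ diag x y - + 1
  diag-delete x y = identity (+ x) (+ y)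
    where
    identity : ∀ x y → y - (+ 1 + x) ≡ (y - x) - + 1
    identity = solve-∀

  diag-insert : ∀ x y → diag x (suc y) ≡ diag x y + + 1
  diag-insert x y = identity (+ x) (+ y)
    where
    identity : ∀ x y → (+ 1 + y) - x ≡ (y - x) + + 1
    identity = solve-∀

  diag-slide : ∀ x y ℓ → diag (x ℕ.+ ℓ) (y ℕ.+ ℓ) ≡ diag x y
  diag-slide x y ℓ rewrite pos-+ x ℓ | pos-+ y ℓ = identity (+ x) (+ y) (+ ℓ)
    where
    identity : ∀ x y ℓ → (y + ℓ) - (x + ℓ) ≡ y - x
    identity = solve-∀

  column-of-diag : ∀ x y j t → diag x y ≡ + t + j * + α → column x j t ≡ + y
  column-of-diag x y j t e =
    trans (cong (λ u → + x + u) (trans (+-comm (j * + α) (+ t)) (sym e))) (identity (+ x) (+ y))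
    where
    identity : ∀ x y → x + (y - x) ≡ y
    identity = solve-∀

  column-slide : ∀ x y j t o → column x j t ≡ + y → column (x ℕ.+ o) j t ≡ + (y ℕ.+ o)
  column-slide x y j t o e rewrite pos-+ x o | pos-+ y o =
    trans (identity (+ x) (+ o) (shift j t)) (cong (_+ + o) e)
    where
    identity : ∀ x o s → (x + o) + s ≡ (x + s) + o
    identity = solve-∀

  column-next-offset : ∀ v j t → ℤ.suc (column v j t) ≡ column v j (suc t)
  column-next-offset v j t = identity (+ v) j (+ α) (+ t)
    where
    identity : ∀ v j a t → + 1 + (v + (j * a + t)) ≡ v + (j * a + (+ 1 + t))
    identity = solve-∀

  column-next-row : ∀ v j t → column (suc v) j t ≡ ℤ.suc (column v j t)
  column-next-row v j t = identity (+ v) j (+ α) (+ t)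
    where
    identity : ∀ v j a t → (+ 1 + v) + (j * a + t) ≡ + 1 + (v + (j * a + t))
    identity = solve-∀

  column-from-left-block : ∀ v j → ℤ.suc (column v (j - + 1) W) ≡ column v j 0
  column-from-left-block v j = identity (+ v) j (+ W)
    where
    identity : ∀ v j w → + 1 + (v + ((j - + 1) * (+ 1 + w) + w)) ≡ v + (j * (+ 1 + w) + + 0)
    identity = solve-∀

  column-from-right-block : ∀ v j → column v (j + + 1) 0 ≡ column (suc v) j W
  column-from-right-block v j = identity (+ v) j (+ W)
    where
    identity : ∀ v j w → v + ((j + + 1) * (+ 1 + w) + + 0) ≡ (+ 1 + v) + (j * (+ 1 + w) + w)
    identity = solve-∀

  column-right-block : ∀ v j → column v (j + + 1) 0 ≡ ℤ.suc (column v j W)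
  column-right-block v j = identity (+ v) j (+ W)
    where
    identity : ∀ v j w → v + ((j + + 1) * (+ 1 + w) + + 0) ≡ + 1 + (v + (j * (+ 1 + w) + w))
    identity = solve-∀

  diag-bounded : ∀ x y k → x ℕ.≤ y ℕ.+ k → y ℕ.≤ x ℕ.+ k → - + k ≤ diag x y × diag x y ≤ + k
  diag-bounded x y k p q with ℕP.≤-total x y
  ... | inj₁ x≤y = subst (- + k ≤_) (sym e) neg-≤-pos ,
                   subst (_≤ + k) (sym e) (+≤+ (ℕP.m≤n+o⇒m∸n≤o y x q))
    where
    e : diag x y ≡ + (y ℕ.∸ x)
    e = trans (m-n≡m⊖n y x) (⊖-≥ x≤y)
  ... | inj₂ y≤x = subst (- + k ≤_) (sym e) (neg-mono-≤ (+≤+ (ℕP.m≤n+o⇒m∸n≤o x y p))) ,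
                   subst (_≤ + k) (sym e) neg-≤-pos
    where
    e : diag x y ≡ - + (x ℕ.∸ y)
    e = trans (m-n≡m⊖n y x) (⊖-≤ y≤x)

  ∣x-y∣≤ : ∀ x y k → x ℕ.≤ y ℕ.+ k → y ℕ.≤ x ℕ.+ k → ℤ.∣ + x - + y ∣ ℕ.≤ k
  ∣x-y∣≤ x y k p q with ℕP.≤-total x y
  ... | inj₁ x≤y = subst (ℕ._≤ k) (sym (trans (cong ℤ.∣_∣ (m-n≡m⊖n x y)) (∣⊖∣-≤ x≤y)))
                     (ℕP.m≤n+o⇒m∸n≤o y x q)
  ... | inj₂ y≤x = subst (ℕ._≤ k)
                     (sym (trans (cong ℤ.∣_∣ (m-n≡m⊖n x y)) (trans (∣m⊖n∣≡∣n⊖m∣ x y) (∣⊖∣-≤ y≤x))))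
                     (ℕP.m≤n+o⇒m∸n≤o x y p)

  -- Block j' neighbours block j, and d'_{·,j} takes d_{·,j'} + g from it
  -- (g = 0 from the left block, g = 1 from the same or the right block).
  data Neighbour (j j' : ℤ) : ℕ → Set where
    left  : j' ≡ j - + 1 → Neighbour j j' 0
    here  : j' ≡ j       → Neighbour j j' 1
    right : j' ≡ j + + 1 → Neighbour j j' 1

  neighbour-diagonal : ∀ x y → Neighbour (block (diag (suc x) (suc y))) (block (diag x y)) 1
  neighbour-diagonal x y = here (cong block (sym (diag-match x y)))

  neighbour-delete : ∀ x y → Neighbour (block (diag (suc x) y)) (block (diag x y)) 1
  neighbour-delete x y with block-pred (diag x y)
  ... | inj₁ e = here (trans (sym e) (cong block (sym (diag-delete x y))))
  ... | inj₂ e = right (trans (sym e) (cong (λ u → block u + + 1) (sym (diag-delete x y))))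

  neighbour-insert : ∀ x y → Σ ℕ λ g → Neighbour (block (diag x (suc y))) (block (diag x y)) g
  neighbour-insert x y with block-suc (diag x y)
  ... | inj₁ e = 1 , here (trans (sym e) (cong block (sym (diag-insert x y))))
  ... | inj₂ e = 0 , left (trans (sym e) (cong (λ u → block u - + 1) (sym (diag-insert x y))))

module Analysis {A : Set} (_≟_ : DecidableEquality A) (X Y : List A) (k W : ℕ) (O : Oracle)
                (valid : ValidOracle _≟_ X Y (suc W) O) where

  open import Data.Nat using (_+_; _*_; _∸_; _≤_; _<_; _⊓_)
  open import Data.Nat.Properties hiding (_≟_)
  open import Data.Integer using (+_)
  open Alignment _≟_ X Y
  open Windows _≟_ X Y
  open Anchoring _≟_ X Y
  open Blocks W
  open Procedure n k (suc W) O

  in-range : ∀ j → lo ℤ.≤ j → j ℤ.≤ hi → inRange? j ≡ true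
  in-range j p q with lo ℤ.≤? j | j ℤ.≤? hi
  ... | yes _ | yes _ = refl
  ... | no ¬p | _     = ⊥-elim (¬p p)
  ... | yes _ | no ¬q = ⊥-elim (¬q q)

  in-band : ∀ {c x y} → Reach c x y → c ≤ k → inRange? (block (diag x y)) ≡ true
  in-band {c} {x} {y} r c≤k =
    let (p , q) = reach-diagonal r
        (lower , upper) = diag-bounded x y k (≤-trans p (+-monoʳ-≤ y c≤k)) (≤-trans q (+-monoʳ-≤ x c≤k))
    in in-range _ (block-mono _ _ lower) (block-mono _ _ upper)

  answer : ℕ → ℤ → ℕ → ℕ → ℕ
  answer i j x t = O i j (shift j t) x (column x j t)

  answer-at : ∀ i j x y t → x ≤ n → y ≤ m → column x j t ≡ + y → Answer W x y (answer i j x t)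
  answer-at i j x y t xn ym e =
    answer-inside (subst (λ z → IsLCE~ _≟_ W X Y (+ x) z (answer i j x t)) e
                         (valid i j (shift j t) x (column x j t))) xn ym

  answer≤maxFrom : ∀ i j x T t → t < T → answer i j x t ≤ maxFrom i j x T
  answer≤maxFrom i j x (suc T) t (s≤s t≤T) with m≤n⇒m<n∨m≡n t≤T
  ... | inj₁ lt   = ≤-trans (answer≤maxFrom i j x T t lt) (m≤n⊔m _ _)
  ... | inj₂ refl = m≤m⊔n _ _

  maxFrom-lub : ∀ i j x T B → (∀ t → t < T → answer i j x t ≤ B) → maxFrom i j x T ≤ B
  maxFrom-lub i j x zero    B _     = z≤n
  maxFrom-lub i j x (suc T) B bound =
    ⊔-lub (bound T ≤-refl) (maxFrom-lub i j x T B (λ t lt → bound t (m≤n⇒m≤1+n lt)))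

  maxFrom-attained : ∀ i j x T → Σ ℕ λ t → t < suc T × maxFrom i j x (suc T) ≡ answer i j x t
  maxFrom-attained i j x zero = 0 , s≤s z≤n , ⊔-identityʳ _
  maxFrom-attained i j x (suc T) with ⊔-sel (answer i j x (suc T)) (maxFrom i j x (suc T))
  ... | inj₁ e = suc T , ≤-refl , e
  ... | inj₂ e = let (t , lt , e') = maxFrom-attained i j x T in t , m≤n⇒m≤1+n lt , trans e e'

  d-of-d' : ∀ {i j x} → inRange? j ≡ true → d' i j ≡ just x → d i j ≡ just (x + maxFrom i j x α)
  d-of-d' {i} {j} in-j e rewrite in-j | e = refl

  d-source : ∀ i j v → d i j ≡ just v → Σ ℕ λ x → d' i j ≡ just x × v ≡ x + maxFrom i j x α
  d-source i j v e with inRange? j | d' i j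
  d-source i j v refl | true  | just x  = x , refl , refl
  d-source i j v ()   | true  | nothing
  d-source i j v ()   | false | _

  d'-from-neighbour : ∀ (r : Row) {j j' g v} → Neighbour j j' g → inRange? j ≡ true →
    r j' ≡ just v → Σ ℕ λ w → d'Step r j ≡ just w × n ⊓ (g + v) ≤ w
  d'-from-neighbour r {j} {v = v} (left refl) in-j e rewrite in-j | e =
    let (w , ew , vw) = max∞-≥ˡ v (max∞ (inc∞ (r j)) (inc∞ (r (j ℤ.+ + 1)))) in
    n ⊓ w , cong (min∞ (just n)) ew , ⊓-monoʳ-≤ n vw
  d'-from-neighbour r {j} {v = v} (here refl) in-j e rewrite in-j | e =
    let (w₁ , e₁ , vw₁) = max∞-≥ˡ (suc v) (inc∞ (r (j ℤ.+ + 1)))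
        (w , ew , w₁w)  = max∞-≥ʳ (r (j ℤ.- + 1)) w₁ in
    n ⊓ w , cong (min∞ (just n)) (trans (cong (max∞ (r (j ℤ.- + 1))) e₁) ew) ,
    ⊓-monoʳ-≤ n (≤-trans vw₁ w₁w)
  d'-from-neighbour r {j} {v = v} (right refl) in-j e rewrite in-j | e =
    let (w₁ , e₁ , vw₁) = max∞-≥ʳ (inc∞ (r j)) (suc v)
        (w , ew , w₁w)  = max∞-≥ʳ (r (j ℤ.- + 1)) w₁ in
    n ⊓ w , cong (min∞ (just n)) (trans (cong (max∞ (r (j ℤ.- + 1))) e₁) ew) ,
    ⊓-monoʳ-≤ n (≤-trans vw₁ w₁w)

  data Source (r : Row) (j : ℤ) (x : ℕ) : Set where
    source : ∀ {j' g} v → Neighbour j j' g → r j' ≡ just v → x ≡ n ⊓ (g + v) → Source r j x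

  d'-source : ∀ (r : Row) j x → d'Step r j ≡ just x → Source r j x
  d'-source r j x e with inRange? j
  d'-source r j x () | false
  ... | true with max∞ (r (j ℤ.- + 1)) (max∞ (inc∞ (r j)) (inc∞ (r (j ℤ.+ + 1)))) in eM
  d'-source r j x ()          | true | nothing
  d'-source r j .(n ⊓ w) refl | true | just w with max∞-sel _ _ w eM
  ... | inj₁ e₁ = source w (left refl) e₁ refl
  ... | inj₂ e₂ with max∞-sel _ _ w e₂
  ...   | inj₁ e₃ = let (v , ev , wv) = inc∞-inv _ w e₃ in source v (here refl) ev (cong (n ⊓_) wv)
  ...   | inj₂ e₃ = let (v , ev , wv) = inc∞-inv _ w e₃ in source v (right refl) ev (cong (n ⊓_) wv)

  d'≤n : ∀ i j x → d' i j ≡ just x → x ≤ n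
  d'≤n zero    (+ zero)     .0 refl = z≤n
  d'≤n zero    (+ suc _)    _  ()
  d'≤n zero    ℤ.-[1+ _ ] _  ()
  d'≤n (suc i) j x e with d'-source (d i) j x e
  ... | source _ _ _ refl = m⊓n≤m _ _

  d≤n : ∀ i j v → d i j ≡ just v → v ≤ n
  d≤n i j v e with d-source i j v e
  ... | x , e' , refl =
    subst (_≤ n) (+-comm _ x) (m≤o∸n⇒m+n≤o _ xn (maxFrom-lub i j x α (n ∸ x) answer≤rest))
    where
    xn = d'≤n i j x e'
    answer≤rest : ∀ t → t < α → answer i j x t ≤ n ∸ x
    answer≤rest t _ = m+n≤o⇒m≤o∸n _ (subst (_≤ n) (+-comm x _)
                        (answer-fits (valid i j (shift j t) x (column x j t)) xn))

  Covers : ℕ → ℕ → ℕ → Set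
  Covers x' x y = x < x' ⊎ Σ ℕ λ ℓ → Σ ℕ λ y' → x ≡ x' + ℓ × y ≡ y' + ℓ × ExactRun x' y' ℓ

  Covered : ℕ → ℕ → ℕ → Set
  Covered c x y = Σ ℕ λ x' → d' c (block (diag x y)) ≡ just x' × Covers x' x y

  Passed : ℕ → ℕ → ℕ → Set
  Passed c x y = Σ ℕ λ v → d c (block (diag x y)) ≡ just v × x ≤ v

  -- The LCE~ answer is at least LCE₀, so it extends d'_{c,j} over any exact run.
  passed-of-covered : ∀ {c x y} → Reach c x y → c ≤ k → Covered c x y → Passed c x y
  passed-of-covered {c} {x} {y} r c≤k (x' , e , cov) =
    x' + maxFrom c j x' α , d-of-d' (in-band r c≤k) e , passes cov
    where
    j = block (diag x y)
    passes : Covers x' x y → x ≤ x' + maxFrom c j x' α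
    passes (inj₁ lt) = ≤-trans (<⇒≤ lt) (m≤m+n _ _)
    passes (inj₂ (ℓ , y' , refl , refl , run)) =
      let x'n = d'≤n c j x' e
          y'm = m+n≤o⇒m≤o y' (proj₂ (reach-bounded r))
          t   = offset (diag x y)
          on-diagonal : column x' j t ≡ + y'
          on-diagonal = column-of-diag x' y' j t
                          (trans (sym (diag-slide x' y' ℓ)) (block-decomp (diag x y)))
          (exact , fitsX , fitsY) = exactRun-window x'n y'm run
      in +-monoʳ-≤ x' (≤-trans (Answer.coversExact (answer-at c j x' y' t x'n y'm on-diagonal)
                                                    ℓ fitsX fitsY exact)
                               (answer≤maxFrom c j x' α t (offset<α (diag x y))))

  covered-of-≤ : ∀ {c x y w} → d' c (block (diag x y)) ≡ just w → x ≤ w → Covered c x y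
  covered-of-≤ {c} {x} {y} {w} e le with m≤n⇒m<n∨m≡n le
  ... | inj₁ lt   = w , e , inj₁ lt
  ... | inj₂ refl = x , e , inj₂ (0 , y , sym (+-identityʳ x) , sym (+-identityʳ y) , empty)

  covered-after-edit : ∀ {c x₀ y₀ x y g} → Reach c x₀ y₀ → Reach (suc c) x y → suc c ≤ k →
    Neighbour (block (diag x y)) (block (diag x₀ y₀)) g → x ≤ g + x₀ →
    Covered c x₀ y₀ → Covered (suc c) x y
  covered-after-edit {c} {g = g} r₀ r c<k nb x≤ cov =
    let (v , ev , x₀≤v) = passed-of-covered r₀ (≤-trans (n≤1+n c) c<k) cov
        (w , ew , vw)   = d'-from-neighbour (d c) nb (in-band r c<k) ev
    in covered-of-≤ {suc c} ew (≤-trans (⊓-glb (proj₁ (reach-bounded r)) (≤-trans x≤ (+-monoʳ-≤ g x₀≤v))) vw)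

  covered : ∀ {c x y} → Reach c x y → c ≤ k → Covered c x y
  covered start _ = 0 , refl , inj₂ (0 , 0 , refl , refl , empty)
  covered (weaken r) c<k =
    covered-after-edit r (weaken r) c<k (here refl) (n≤1+n _) (covered r (≤-trans (n≤1+n _) c<k))
  covered {c} (match {x = x} {y = y} r a e₁ e₂) c≤k with covered r c≤k
  ... | x' , e , inj₁ lt =
    covered-of-≤ {c} (subst (λ z → d' c (block z) ≡ just x') (sym (diag-match x y)) e) lt
  ... | x' , e , inj₂ (ℓ , y' , refl , refl , run) =
    x' , subst (λ z → d' c (block z) ≡ just x') (sym (diag-match x y)) e ,
    inj₂ (suc ℓ , y' , sym (+-suc x' ℓ) , sym (+-suc y' ℓ) , exactRun-snoc run a e₁ e₂)
  covered (substitute {x = x} {y = y} r p q) c<k =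
    covered-after-edit r (substitute r p q) c<k (neighbour-diagonal x y) ≤-refl
      (covered r (≤-trans (n≤1+n _) c<k))
  covered (delete {x = x} {y = y} r p) c<k =
    covered-after-edit r (delete r p) c<k (neighbour-delete x y) ≤-refl
      (covered r (≤-trans (n≤1+n _) c<k))
  covered (insert {x = x} {y = y} r q) c<k =
    let (g , nb) = neighbour-insert x y in
    covered-after-edit r (insert r q) c<k nb (m≤n+m x g) (covered r (≤-trans (n≤1+n _) c<k))

  final-entry-complete : ED _≟_ X Y ≤ k → d k (block (diag n m)) ≡ just n
  final-entry-complete h =
    let r = reach-mono h reach-of-ED
        (v , ev , nv) = passed-of-covered r ≤-refl (covered r ≤-refl)
    in trans ev (cong just (≤-antisym (d≤n k _ v ev) nv))

  AnchoredBlock : ℕ → ℕ → ℤ → Set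
  AnchoredBlock c v j = ∀ t → t < α → Anchored c v (column v j t)

  anchored-offset-up : ∀ s {c v j t} → Anchored c v (column v j t) →
                       Anchored (c + s) v (column v j (s + t))
  anchored-offset-up zero {c} {v} {j} {t} G =
    subst (λ a → Anchored a v (column v j t)) (sym (+-identityʳ c)) G
  anchored-offset-up (suc s) {c} {v} {j} {t} G =
    subst₂ (λ a z → Anchored a v z) (sym (+-suc c s)) (column-next-offset v j (s + t))
      (anchored-up (anchored-offset-up s {c} {v} {j} {t} G))

  anchored-offset-down : ∀ s {c v j t} → Anchored c v (column v j (s + t)) →
                         Anchored (c + s) v (column v j t)
  anchored-offset-down zero {c} {v} {j} {t} G =
    subst (λ a → Anchored a v (column v j t)) (sym (+-identityʳ c)) G
  anchored-offset-down (suc s) {c} {v} {j} {t} G =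
    subst (λ a → Anchored a v (column v j t)) (sym (+-suc c s))
      (anchored-offset-down s {suc c} {v} {j} {t}
        (anchored-down (subst (Anchored c v) (sym (column-next-offset v j (s + t))) G)))

  -- Any two offsets of a block are at most α − 1 = W apart.
  anchored-in-block : ∀ {c v j t} t' → Anchored c v (column v j t) → t < α → t' < α →
                      Anchored (c + W) v (column v j t')
  anchored-in-block {c} {v} {j} {t} t' G t<α t'<α with ≤-total t t'
  ... | inj₁ t≤t' = anchored-mono (+-monoʳ-≤ c (≤-trans (m∸n≤m t' t) (≤-pred t'<α)))
      (subst (λ u → Anchored (c + (t' ∸ t)) v (column v j u)) (m∸n+n≡m t≤t')
        (anchored-offset-up (t' ∸ t) {c} {v} {j} {t} G))
  ... | inj₂ t'≤t = anchored-mono (+-monoʳ-≤ c (≤-trans (m∸n≤m t t') (≤-pred t<α)))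
      (anchored-offset-down (t ∸ t') {c} {v} {j} {t'}
        (subst (λ u → Anchored c v (column v j u)) (sym (m∸n+n≡m t'≤t)) G))

  -- Cost budgets of the entries d'_{i,·} and d_{i,·}: a step between rows
  -- costs 1 + W, an LCE~ answer costs W, and changing offsets costs W.
  budget' budget : ℕ → ℕ
  budget' zero    = W
  budget' (suc i) = budget i + suc W
  budget i = budget' i + W + W

  budget-closed-form : ∀ i → budget i ≡ i + 3 * (i + 1) * W
  budget-closed-form zero = identity W
    where
    open import Data.Nat.Tactic.RingSolver using (solve-∀)
    identity : ∀ W → W + W + W ≡ 0 + 3 * (0 + 1) * W
    identity = solve-∀
  budget-closed-form (suc i) rewrite budget-closed-form i = identity i W
    where
    open import Data.Nat.Tactic.RingSolver using (solve-∀)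
    identity : ∀ i W → i + 3 * (i + 1) * W + suc W + W + W ≡ suc i + 3 * (suc i + 1) * W
    identity = solve-∀

  spread : ∀ i {u} j t₀ t → Anchored (suc (budget i)) u (column u j t₀) → t₀ < α → t < α →
           Anchored (budget' (suc i)) u (column u j t)
  spread i {u} j t₀ t G t₀<α t<α =
    subst (λ a → Anchored a u (column u j t)) (sym (+-suc (budget i) W)) (anchored-in-block {j = j} t G t₀<α t<α)

  at-row : ∀ {c u u'} j t → u ≡ u' → Anchored c u (column u j t) → Anchored c u' (column u' j t)
  at-row {c} j t = subst (λ u → Anchored c u (column u j t))

  mutual
    -- d'_{0,0} = 0 is anchored at the origin; d'_{i+1,j} inherits the
    -- anchoring of its source neighbour through one edit step.
    anchored-d' : ∀ i j x → d' i j ≡ just x → AnchoredBlock (budget' i) x j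
    anchored-d' zero (+ zero) .0 refl t t<α =
      anchored-mono (≤-pred t<α)
        (subst (λ u → Anchored t 0 (column 0 (+ 0) u)) (+-identityʳ t)
          (anchored-offset-up t {0} {0} {+ 0} {0} (anchored-of-reach start)))
    anchored-d' zero    (+ suc _)    _ ()
    anchored-d' zero    ℤ.-[1+ _ ] _ ()
    anchored-d' (suc i) j x e t t<α with d'-source (d i) j x e
    ... | source v (left refl) ev refl =
      at-row j t (sym (m≥n⇒m⊓n≡n (d≤n i _ v ev)))
        (spread i j 0 t (subst (Anchored (suc (budget i)) v) (column-from-left-block v j)
                      (anchored-up (anchored-d i (j ℤ.- + 1) v ev W ≤-refl)))
                (s≤s z≤n) t<α)
    ... | source v (here refl) ev refl with m≤n⇒m<n∨m≡n (d≤n i j v ev)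
    ...   | inj₁ v<n = at-row j t (sym (m≥n⇒m⊓n≡n v<n))
      (spread i j t t (subst (Anchored (suc (budget i)) (suc v)) (sym (column-next-row v j t))
                    (anchored-substitute (anchored-d i j v ev t t<α) v<n))
              t<α t<α)
    ...   | inj₂ refl = at-row j t (sym (m≤n⇒m⊓n≡m (n≤1+n n)))
      (spread i j t t (anchored-mono (n≤1+n _) (anchored-d i j n ev t t<α)) t<α t<α)
    anchored-d' (suc i) j x e t t<α | source v (right refl) ev refl
      with m≤n⇒m<n∨m≡n (d≤n i _ v ev)
    ...   | inj₁ v<n = at-row j t (sym (m≥n⇒m⊓n≡n v<n))
      (spread i j W t (subst (Anchored (suc (budget i)) (suc v)) (column-from-right-block v j)
                    (anchored-delete (anchored-d i (j ℤ.+ + 1) v ev 0 (s≤s z≤n)) v<n))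
              ≤-refl t<α)
    ...   | inj₂ refl = at-row j t (sym (m≤n⇒m⊓n≡m (n≤1+n n)))
      (spread i j W t (anchored-down (subst (Anchored (budget i) n) (column-right-block n j)
                                   (anchored-d i (j ℤ.+ + 1) n ev 0 (s≤s z≤n))))
              ≤-refl t<α)

    -- d_{i,j} = x + o where o is the best answer, at some offset s: the
    -- answered window has at most W mismatches, so it costs at most W.
    anchored-d : ∀ i j v → d i j ≡ just v → AnchoredBlock (budget i) v j
    anchored-d i j v e t t<α with d-source i j v e
    ... | x , e' , refl with maxFrom-attained i j x W
    ...   | s , s<α , best with answer-cases (valid i j (shift j s) x (column x j s)) (d'≤n i j x e')
    ...     | inj₁ (b , on-column , ans) =
      let o  = answer i j x s
          Rb = reach-of-anchored (subst (Anchored (budget' i) x) on-column (anchored-d' i j x e' s s<α))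
                                 (≤-trans (m≤m+n b o) (Answer.fitsY ans))
          Ro = reach-along-diagonal o Rb (Answer.fewMismatches ans) (Answer.fitsX ans) (Answer.fitsY ans)
          G  = subst (Anchored (budget' i + W) (x + o)) (sym (column-slide x b j s o on-column))
                     (anchored-of-reach Ro)
      in at-row j t (cong (_+_ x) (sym best)) (anchored-in-block {j = j} t G s<α t<α)
    ...     | inj₂ o≡0 =
      at-row j t (sym (trans (cong (_+_ x) (trans best o≡0)) (+-identityʳ x)))
        (anchored-mono (m≤m+n (budget' i + W) W) (anchored-in-block {j = j} t (anchored-d' i j x e' s s<α) s<α t<α))

  final-entry-sound : d k (block (diag n m)) ≡ just n → ED _≟_ X Y ≤ budget k
  final-entry-sound e =
    let j = block (diag n m)
        t = offset (diag n m)
        on-column = column-of-diag n m j t (block-decomp (diag n m))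
        G = anchored-d k j n e t (offset<α (diag n m))
    in ED≤reach (reach-of-anchored (subst (Anchored (budget k) n) on-column G) ≤-refl)

  accepts : ED _≟_ X Y ≤ k → run _≟_ X Y k (suc W) O ≡ true
  accepts h with ℤ.∣ + n ℤ.- + m ∣ ℕ.≤? k
  ... | no ¬band = ⊥-elim (¬band (let (p , q) = reach-diagonal (reach-mono h reach-of-ED) in ∣x-y∣≤ n m k p q))
  ... | yes _ rewrite final-entry-complete h with n ℕ.≟ n
  ...   | yes _ = refl
  ...   | no ¬p = ⊥-elim (¬p refl)

  rejects : k + 3 * (k + 1) * W < ED _≟_ X Y → run _≟_ X Y k (suc W) O ≡ false
  rejects h with ℤ.∣ + n ℤ.- + m ∣ ℕ.≤? k
  ... | no _ = refl
  ... | yes _ with d k (block (diag n m)) in e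
  ...   | nothing = refl
  ...   | just v with v ℕ.≟ n
  ...     | no _     = refl
  ...     | yes refl = ⊥-elim (<⇒≱ h (subst (ED _≟_ X Y ≤_) (budget-closed-form k) (final-entry-sound e)))

open import Data.Nat using (_+_; _*_; _∸_; _≤_; _<_)

lemma4p1 : {A : Set} (_≟_ : DecidableEquality A) (X Y : List A) (k α : ℕ)
    .{{_ : NonZero α}} (O : Oracle) → ValidOracle _≟_ X Y α O →
    (ED _≟_ X Y ≤ k → run _≟_ X Y k α O ≡ true) ×
    (k + 3 * (k + 1) * (α ∸ 1) < ED _≟_ X Y → run _≟_ X Y k α O ≡ false)
lemma4p1 _≟_ X Y k (suc W) O valid = accepts , rejects
  where open Analysis _≟_ X Y k W O valid
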